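{- For $i\in\{1,2\}$, let $k_i\in\mathbb{Z}^+$ and let $G_i$ be a finite $3k_i$-regular graph, with $G_1,G_2$ vertex-disjoint. Suppose $G_1$ and $G_2$ are 3-balanced. Then the join $G_1\nabla G_2$ is 3-balanced.
   Context: The join $G_1\nabla G_2$ of vertex-disjoint graphs is obtained from their disjoint union by adding all edges between a vertex of $G_1$ and a vertex of $G_2$. A graph is 3-balanced if it admits a vertex coloring $\ell:V\to\mathbb{Z}_3$ such that every vertex has, in its open neighborhood, the same number of vertices of each of the three colors. -}

module Defs where

open import Data.Nat using (ℕ; zero; suc; _+_; _*_)
open import Data.Bool using (Bool; true; false; _∧_; if_then_else_)
open import Data.Fin using (Fin; zero; suc; splitAt)
open import Data.Fin.Properties using (_≟_)
open import Data.Sum using (_⊎_; inj₁; inj₂)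
open import Data.Product using (Σ; _,_)
open import Relation.Nullary.Decidable using (⌊_⌋)
open import Relation.Binary.PropositionalEquality using (_≡_; refl)

record Graph (n : ℕ) : Set where
  field
    adj    : Fin n → Fin n → Bool
    sym    : ∀ u v → adj u v ≡ adj v u
    irrefl : ∀ v → adj v v ≡ false
open Graph public

count : ∀ {n} → (Fin n → Bool) → ℕ
count {zero}  P = 0
count {suc n} P = (if P zero then 1 else 0) + count (λ i → P (suc i))

degree : ∀ {n} → Graph n → Fin n → ℕ
degree G v = count (adj G v)

Regular : ∀ {n} → ℕ → Graph n → Set
Regular d G = ∀ v → degree G v ≡ d

colourCount : ∀ {n} → Graph n → (Fin n → Fin 3) → Fin n → Fin 3 → ℕ
colourCount G ℓ v c = count (λ w → adj G v w ∧ ⌊ ℓ w ≟ c ⌋)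

ThreeBalanced : ∀ {n} → Graph n → Set
ThreeBalanced {n} G =
  Σ (Fin n → Fin 3) λ ℓ → ∀ v (c c' : Fin 3) → colourCount G ℓ v c ≡ colourCount G ℓ v c'

-- Join of two vertex-disjoint graphs: vertex set Fin (m + n) = Fin m ⊎ Fin n
-- (via splitAt); edges within each part as in G₁, G₂, all cross edges added.
joinAdj : ∀ {m n} → Graph m → Graph n → Fin (m + n) → Fin (m + n) → Bool
joinAdj {m} G₁ G₂ u v with splitAt m u | splitAt m v
... | inj₁ i | inj₁ j = adj G₁ i j
... | inj₁ i | inj₂ j = true
... | inj₂ i | inj₁ j = true
... | inj₂ i | inj₂ j = adj G₂ i j

private
  joinSym : ∀ {m n} (G₁ : Graph m) (G₂ : Graph n) u v →
            joinAdj G₁ G₂ u v ≡ joinAdj G₁ G₂ v u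
  joinSym {m} G₁ G₂ u v with splitAt m u | splitAt m v
  ... | inj₁ i | inj₁ j = sym G₁ i j
  ... | inj₁ i | inj₂ j = refl
  ... | inj₂ i | inj₁ j = refl
  ... | inj₂ i | inj₂ j = sym G₂ i j

  joinIrrefl : ∀ {m n} (G₁ : Graph m) (G₂ : Graph n) v → joinAdj G₁ G₂ v v ≡ false
  joinIrrefl {m} G₁ G₂ v with splitAt m v
  ... | inj₁ i = irrefl G₁ i
  ... | inj₂ i = irrefl G₂ i

_∇_ : ∀ {m n} → Graph m → Graph n → Graph (m + n)
G₁ ∇ G₂ = record { adj = joinAdj G₁ G₂ ; sym = joinSym G₁ G₂ ; irrefl = joinIrrefl G₁ G₂ }

{-# OPTIONS --safe #-}
module Submission where

-- Double counting the pairs (v, w) with w a neighbour of v of colour c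
-- shows that in a d-regular graph with d ≠ 0 the size of colour class c is
-- (Σ_v colourCount v c) / d, so a balanced colouring has equal colour classes.
-- Colour the join by ℓ₁ on G₁ and ℓ₂ on G₂: a vertex of G₁ sees its balanced
-- G₁-neighbourhood together with all of G₂, whose colour classes are equal,
-- and symmetrically for G₂.

open import Defs hiding (sym)
open import Data.Nat.Properties using (+-assoc; *-cancelˡ-≡; +-*-semiring)
open import Algebra.Properties.Semiring.Sum +-*-semiring
  using (sum-syntax; sum-cong-≗; ∑-comm; *-distribˡ-sum; *-distribʳ-sum)
open import Data.Bool using (Bool; true; false; _∧_; if_then_else_)
open import Data.Fin using (Fin; zero; suc; splitAt; join; _↑ˡ_; _↑ʳ_)
open import Data.Fin.Properties using (_≟_; splitAt-↑ˡ; splitAt-↑ʳ; join-splitAt)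
open import Data.Nat using (ℕ; _+_; _*_; _≤_; s≤s; z≤n; NonZero)
open import Data.Product using (_,_)
open import Data.Sum using (inj₁; inj₂; [_,_]′)
open import Function using (_∘_)
open import Relation.Nullary.Decidable using (⌊_⌋)
open import Relation.Binary.PropositionalEquality
  using (_≡_; _≗_; refl; sym; trans; cong; cong₂; subst; module ≡-Reasoning)

indicator : Bool → ℕ
indicator b = if b then 1 else 0

indicator-∧ : ∀ a b → indicator (a ∧ b) ≡ indicator a * indicator b
indicator-∧ false b     = refl
indicator-∧ true  false = refl
indicator-∧ true  true  = refl

count≡∑ : ∀ {n} (P : Fin n → Bool) → count P ≡ ∑[ i < n ] indicator (P i)
count≡∑ {ℕ.zero} P = refl
count≡∑ {ℕ.suc n} P = cong (indicator (P zero) +_) (count≡∑ (P ∘ suc))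

count-cong : ∀ {n} {P Q : Fin n → Bool} → P ≗ Q → count P ≡ count Q
count-cong {ℕ.zero}  P≗Q = refl
count-cong {ℕ.suc n} P≗Q = cong₂ _+_ (cong indicator (P≗Q zero)) (count-cong (P≗Q ∘ suc))

count-splitAt : ∀ m {n} (P : Fin (m + n) → Bool) →
                count P ≡ count (λ i → P (i ↑ˡ n)) + count (λ j → P (m ↑ʳ j))
count-splitAt ℕ.zero    P = refl
count-splitAt (ℕ.suc m) P =
  trans (cong (indicator (P zero) +_) (count-splitAt m (P ∘ suc)))
        (sym (+-assoc (indicator (P zero)) _ _))

↑-elim : ∀ m {n} (P : Fin (m + n) → Set) →
         (∀ i → P (i ↑ˡ n)) → (∀ j → P (m ↑ʳ j)) → ∀ u → P u
↑-elim m {n} P left right u = subst P (join-splitAt m n u) (elim-join (splitAt m u))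
  where
  elim-join : ∀ s → P (join m n s)
  elim-join (inj₁ i) = left i
  elim-join (inj₂ j) = right j

colourClassSize : ∀ {n} → (Fin n → Fin 3) → Fin 3 → ℕ
colourClassSize ℓ c = count (λ w → ⌊ ℓ w ≟ c ⌋)

Balanced : ∀ {n} → Graph n → (Fin n → Fin 3) → Set
Balanced G ℓ = ∀ v c c' → colourCount G ℓ v c ≡ colourCount G ℓ v c'

Equitable : ∀ {n} → (Fin n → Fin 3) → Set
Equitable ℓ = ∀ c c' → colourClassSize ℓ c ≡ colourClassSize ℓ c'

∑-count-adj∧≡*count : ∀ {n d} (G : Graph n) → Regular d G → (Q : Fin n → Bool) →
                      ∑[ v < n ] count (λ w → adj G v w ∧ Q w) ≡ d * count Q
∑-count-adj∧≡*count {n} {d} G regular Q = begin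
  ∑[ v < n ] count (λ w → adj G v w ∧ Q w)
    ≡⟨ sum-cong-≗ (λ v → count≡∑ (λ w → adj G v w ∧ Q w)) ⟩
  ∑[ v < n ] ∑[ w < n ] indicator (adj G v w ∧ Q w)
    ≡⟨ sum-cong-≗ (λ v → sum-cong-≗ (λ w → indicator-∧ (adj G v w) (Q w))) ⟩
  ∑[ v < n ] ∑[ w < n ] (indicator (adj G v w) * indicator (Q w))
    ≡⟨ ∑-comm (λ v w → indicator (adj G v w) * indicator (Q w)) ⟩
  ∑[ w < n ] ∑[ v < n ] (indicator (adj G v w) * indicator (Q w))
    ≡⟨ sum-cong-≗ (λ w → sym (*-distribʳ-sum (indicator (Q w)) (λ v → indicator (adj G v w)))) ⟩
  ∑[ w < n ] ((∑[ v < n ] indicator (adj G v w)) * indicator (Q w))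
    ≡⟨ sum-cong-≗ (λ w → cong (_* indicator (Q w)) (degree≡∑ w)) ⟩
  ∑[ w < n ] (d * indicator (Q w))
    ≡⟨ sym (*-distribˡ-sum d (indicator ∘ Q)) ⟩
  d * ∑[ w < n ] indicator (Q w)
    ≡⟨ cong (d *_) (sym (count≡∑ Q)) ⟩
  d * count Q ∎
  where
  open ≡-Reasoning
  degree≡∑ : ∀ w → ∑[ v < n ] indicator (adj G v w) ≡ d
  degree≡∑ w = begin
    ∑[ v < n ] indicator (adj G v w) ≡⟨ sum-cong-≗ (λ v → cong indicator (Graph.sym G v w)) ⟩
    ∑[ v < n ] indicator (adj G w v) ≡⟨ sym (count≡∑ (adj G w)) ⟩
    degree G w                       ≡⟨ regular w ⟩
    d                                ∎

balanced⇒equitable : ∀ {n d} .{{_ : NonZero d}} (G : Graph n) {ℓ : Fin n → Fin 3} →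
                     Regular d G → Balanced G ℓ → Equitable ℓ
balanced⇒equitable {n} {d} G {ℓ} regular balanced c c' = *-cancelˡ-≡ _ _ d (begin
  d * colourClassSize ℓ c           ≡⟨ sym (∑-count-adj∧≡*count G regular (λ w → ⌊ ℓ w ≟ c ⌋)) ⟩
  ∑[ v < n ] colourCount G ℓ v c    ≡⟨ sum-cong-≗ (λ v → balanced v c c') ⟩
  ∑[ v < n ] colourCount G ℓ v c'   ≡⟨ ∑-count-adj∧≡*count G regular (λ w → ⌊ ℓ w ≟ c' ⌋) ⟩
  d * colourClassSize ℓ c'          ∎)
  where open ≡-Reasoning

joinColouring : ∀ {m n} → (Fin m → Fin 3) → (Fin n → Fin 3) → Fin (m + n) → Fin 3
joinColouring {m} ℓ₁ ℓ₂ = [ ℓ₁ , ℓ₂ ]′ ∘ splitAt m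

joinColouring-↑ˡ : ∀ {m n} (ℓ₁ : Fin m → Fin 3) (ℓ₂ : Fin n → Fin 3) i →
                   joinColouring ℓ₁ ℓ₂ (i ↑ˡ n) ≡ ℓ₁ i
joinColouring-↑ˡ {m} {n} ℓ₁ ℓ₂ i = cong [ ℓ₁ , ℓ₂ ]′ (splitAt-↑ˡ m i n)

joinColouring-↑ʳ : ∀ {m n} (ℓ₁ : Fin m → Fin 3) (ℓ₂ : Fin n → Fin 3) j →
                   joinColouring ℓ₁ ℓ₂ (m ↑ʳ j) ≡ ℓ₂ j
joinColouring-↑ʳ {m} {n} ℓ₁ ℓ₂ j = cong [ ℓ₁ , ℓ₂ ]′ (splitAt-↑ʳ m n j)

module _ {m n} (G₁ : Graph m) (G₂ : Graph n) where

  ∇-adj-↑ˡ-↑ˡ : ∀ i i' → adj (G₁ ∇ G₂) (i ↑ˡ n) (i' ↑ˡ n) ≡ adj G₁ i i'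
  ∇-adj-↑ˡ-↑ˡ i i' rewrite splitAt-↑ˡ m i n | splitAt-↑ˡ m i' n = refl

  ∇-adj-↑ˡ-↑ʳ : ∀ i j → adj (G₁ ∇ G₂) (i ↑ˡ n) (m ↑ʳ j) ≡ true
  ∇-adj-↑ˡ-↑ʳ i j rewrite splitAt-↑ˡ m i n | splitAt-↑ʳ m n j = refl

  ∇-adj-↑ʳ-↑ˡ : ∀ j i → adj (G₁ ∇ G₂) (m ↑ʳ j) (i ↑ˡ n) ≡ true
  ∇-adj-↑ʳ-↑ˡ j i rewrite splitAt-↑ʳ m n j | splitAt-↑ˡ m i n = refl

  ∇-adj-↑ʳ-↑ʳ : ∀ j j' → adj (G₁ ∇ G₂) (m ↑ʳ j) (m ↑ʳ j') ≡ adj G₂ j j'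
  ∇-adj-↑ʳ-↑ʳ j j' rewrite splitAt-↑ʳ m n j | splitAt-↑ʳ m n j' = refl

  module _ (ℓ₁ : Fin m → Fin 3) (ℓ₂ : Fin n → Fin 3) where

    private
      ℓ : Fin (m + n) → Fin 3
      ℓ = joinColouring ℓ₁ ℓ₂

      adjacentOfColour : Fin 3 → Bool → Fin 3 → Bool
      adjacentOfColour c a x = a ∧ ⌊ x ≟ c ⌋

    colourCount-∇-↑ˡ : ∀ i c → colourCount (G₁ ∇ G₂) ℓ (i ↑ˡ n) c ≡
                               colourCount G₁ ℓ₁ i c + colourClassSize ℓ₂ c
    colourCount-∇-↑ˡ i c = trans (count-splitAt m _) (cong₂ _+_
      (count-cong λ i' → cong₂ (adjacentOfColour c) (∇-adj-↑ˡ-↑ˡ i i') (joinColouring-↑ˡ ℓ₁ ℓ₂ i'))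
      (count-cong λ j  → cong₂ (adjacentOfColour c) (∇-adj-↑ˡ-↑ʳ i j) (joinColouring-↑ʳ ℓ₁ ℓ₂ j)))

    colourCount-∇-↑ʳ : ∀ j c → colourCount (G₁ ∇ G₂) ℓ (m ↑ʳ j) c ≡
                               colourClassSize ℓ₁ c + colourCount G₂ ℓ₂ j c
    colourCount-∇-↑ʳ j c = trans (count-splitAt m _) (cong₂ _+_
      (count-cong λ i  → cong₂ (adjacentOfColour c) (∇-adj-↑ʳ-↑ˡ j i) (joinColouring-↑ˡ ℓ₁ ℓ₂ i))
      (count-cong λ j' → cong₂ (adjacentOfColour c) (∇-adj-↑ʳ-↑ʳ j j') (joinColouring-↑ʳ ℓ₁ ℓ₂ j')))

    ∇-balanced : Balanced G₁ ℓ₁ → Balanced G₂ ℓ₂ → Equitable ℓ₁ → Equitable ℓ₂ →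
                 Balanced (G₁ ∇ G₂) ℓ
    ∇-balanced balanced₁ balanced₂ equitable₁ equitable₂ u c c' =
      ↑-elim m (λ u → colourCount (G₁ ∇ G₂) ℓ u c ≡ colourCount (G₁ ∇ G₂) ℓ u c') left right u
      where
      open ≡-Reasoning
      left : ∀ i → colourCount (G₁ ∇ G₂) ℓ (i ↑ˡ n) c ≡ colourCount (G₁ ∇ G₂) ℓ (i ↑ˡ n) c'
      left i = begin
        colourCount (G₁ ∇ G₂) ℓ (i ↑ˡ n) c             ≡⟨ colourCount-∇-↑ˡ i c ⟩
        colourCount G₁ ℓ₁ i c + colourClassSize ℓ₂ c   ≡⟨ cong₂ _+_ (balanced₁ i c c') (equitable₂ c c') ⟩
        colourCount G₁ ℓ₁ i c' + colourClassSize ℓ₂ c' ≡⟨ sym (colourCount-∇-↑ˡ i c') ⟩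
        colourCount (G₁ ∇ G₂) ℓ (i ↑ˡ n) c'            ∎
      right : ∀ j → colourCount (G₁ ∇ G₂) ℓ (m ↑ʳ j) c ≡ colourCount (G₁ ∇ G₂) ℓ (m ↑ʳ j) c'
      right j = begin
        colourCount (G₁ ∇ G₂) ℓ (m ↑ʳ j) c             ≡⟨ colourCount-∇-↑ʳ j c ⟩
        colourClassSize ℓ₁ c + colourCount G₂ ℓ₂ j c   ≡⟨ cong₂ _+_ (equitable₁ c c') (balanced₂ j c c') ⟩
        colourClassSize ℓ₁ c' + colourCount G₂ ℓ₂ j c' ≡⟨ sym (colourCount-∇-↑ʳ j c') ⟩
        colourCount (G₁ ∇ G₂) ℓ (m ↑ʳ j) c'            ∎

theorem6p6 : ∀ {n₁ n₂ : ℕ} (k₁ k₂ : ℕ) (G₁ : Graph n₁) (G₂ : Graph n₂) →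
    1 ≤ k₁ → 1 ≤ k₂ →
    Regular (3 * k₁) G₁ → Regular (3 * k₂) G₂ →
    ThreeBalanced G₁ → ThreeBalanced G₂ →
    ThreeBalanced (G₁ ∇ G₂)
theorem6p6 _ _ G₁ G₂ (s≤s z≤n) (s≤s z≤n) regular₁ regular₂ (ℓ₁ , balanced₁) (ℓ₂ , balanced₂) =
  joinColouring ℓ₁ ℓ₂ ,
  ∇-balanced G₁ G₂ ℓ₁ ℓ₂ balanced₁ balanced₂
    (balanced⇒equitable G₁ regular₁ balanced₁)
    (balanced⇒equitable G₂ regular₂ balanced₂)
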